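{- The smallest integer $n\ge 2$ such that there exists a connected graph in $\mathfrak{Gr}(n,n,2)$ is $n=7$. Likewise, the smallest integer $n\ge2$ such that there exists a graph without isolated vertices in $\mathfrak{Gr}(n,n,2)$ is $n=7$.
   Context: All graphs are finite, simple and undirected. For a graph $G=(V,E)$ and $x\in V$, $N[x]=\{x\}\cup\{y: xy\in E\}$; for $X\subseteq V$, $N[X]=\bigcup_{x\in X}N[x]$ (so $N[\emptyset]=\emptyset$). A set $C\subseteq V$ is $(1,\le\ell)$-identifying if $N[X]\cap C\neq N[Y]\cap C$ for all distinct $X,Y\subseteq V$ with $|X|\le\ell$, $|Y|\le\ell$. For $n\ge k\ge1$ and $\ell\ge1$, $\mathfrak{Gr}(n,k,\ell)$ is the set of graphs on $n$ vertices in which every $k$-element subset of vertices is $(1,\le\ell)$-identifying; in particular $G\in\mathfrak{Gr}(n,n,2)$ means that the whole vertex set of $G$ is $(1,\le2)$-identifying. An isolated vertex is a vertex of degree $0$. -}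

module Defs where

open import Data.Nat using (ℕ; zero; suc; _≤_)
open import Data.Bool using (Bool; true; false; _∨_; _∧_)
open import Data.Fin using (Fin; zero; suc; _≟_)
open import Data.Fin.Subset using (Subset; _∩_; ∣_∣)
open import Data.Vec using (tabulate; lookup)
open import Data.Product using (Σ; ∃; _×_)
open import Relation.Nullary using (¬_)
open import Relation.Nullary.Decidable using (⌊_⌋)
open import Relation.Binary.PropositionalEquality using (_≡_; _≢_)

record Graph (n : ℕ) : Set where
  field
    adj    : Fin n → Fin n → Bool
    sym    : ∀ x y → adj x y ≡ adj y x
    irrefl : ∀ x → adj x x ≡ false
open Graph public

anyFin : ∀ {n} → (Fin n → Bool) → Bool
anyFin {zero}  f = false
anyFin {suc n} f = f zero ∨ anyFin (λ i → f (suc i))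

N[_∣_] : ∀ {n} → Graph n → Fin n → Subset n
N[ G ∣ x ] = tabulate (λ y → ⌊ x ≟ y ⌋ ∨ adj G x y)

NS[_∣_] : ∀ {n} → Graph n → Subset n → Subset n
NS[ G ∣ X ] = tabulate (λ y → anyFin (λ x → lookup X x ∧ lookup N[ G ∣ x ] y))

Identifying : ∀ {n} → Graph n → ℕ → Subset n → Set
Identifying {n} G ℓ C = ∀ (X Y : Subset n) → X ≢ Y → ∣ X ∣ ≤ ℓ → ∣ Y ∣ ≤ ℓ →
                        (NS[ G ∣ X ] ∩ C) ≢ (NS[ G ∣ Y ] ∩ C)

InGr : ∀ {n} → Graph n → ℕ → ℕ → Set
InGr {n} G k ℓ = ∀ (C : Subset n) → ∣ C ∣ ≡ k → Identifying G ℓ C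

data Reach {n} (G : Graph n) : Fin n → Fin n → Set where
  here : ∀ {x} → Reach G x x
  step : ∀ {x y z} → adj G x y ≡ true → Reach G y z → Reach G x z

Connected : ∀ {n} → Graph n → Set
Connected {n} G = ∀ (x y : Fin n) → Reach G x y

NoIsolated : ∀ {n} → Graph n → Set
NoIsolated {n} G = ∀ (x : Fin n) → ∃ λ (y : Fin n) → adj G x y ≡ true

module Submission where

-- Call X ≠ Y with |X|, |Y| ≤ 2 confusable when N[X] = N[Y]; the whole vertex set is
-- (1,≤2)-identifying exactly when there is no confusable pair. On seven vertices the cycle C₇
-- has none, which is checked over all pairs of vertex sets. For 2 ≤ n ≤ 6 every graph without
-- isolated vertices (in particular every connected graph) has a confusable pair: graphs on
-- Fin n are enumerated through the upper triangle of their adjacency matrix, a pair is found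
-- for each by search, and it carries over to any graph with the same adjacency function
-- since N[X] depends on nothing else.

open import Defs
open import Data.Nat using (ℕ; _≤_; _<_)
open import Data.Product using (Σ; ∃; _×_)
open import Relation.Nullary using (¬_)

open import Data.Nat using (zero; suc; z≤n; s≤s; _≤?_)
open import Data.Bool using (Bool; true; false; _∨_; _∧_; T)
open import Function using (_∘_; Equivalence)
open Equivalence using (to; from)
open import Data.Bool.Properties using (T-∧; T-≡) renaming (_≟_ to _≟ᵇ_)
open import Data.Unit using (tt) renaming (⊤ to Unit)
open import Data.Fin using (Fin; zero; suc; inject₁; _≟_)
open import Data.Fin.Properties using (all?; any?)
open import Data.Fin.Induction using (<-weakInduction)
open import Data.Fin.Subset using (Subset; ⊤; _∩_; ∣_∣)
open import Data.Fin.Subset.Properties using (anySubset?; ∣⊤∣≡n; ∣p∣≡n⇒p≡⊤; ∩-identityʳ)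
open import Data.Vec using ([]; _∷_; tabulate; lookup)
open import Data.Vec.Properties using (lookup∘tabulate; tabulate-cong) renaming (≡-dec to ≡-decᵛ)
open import Data.List using (List; []; _∷_; _++_; map)
open import Data.List.Relation.Unary.Any using (Any; satisfied) renaming (any? to anyˡ?)
open import Data.Product using (_,_; proj₁; proj₂; ∃₂; uncurry)
open import Relation.Nullary using (Dec; does; _because_; ¬?)
open import Relation.Nullary.Reflects using (invert)
open import Relation.Nullary.Decidable using (⌊_⌋; _×-dec_; _→-dec_; from-yes; from-no)
open import Relation.Binary.PropositionalEquality as ≡ using (_≡_; _≢_; refl; trans; cong; cong₂; module ≡-Reasoning)

private
  variable
    n : ℕ

Reach-trans : {G : Graph n} {x y z : Fin n} → Reach G x y → Reach G y z → Reach G x z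
Reach-trans here         r = r
Reach-trans (step xy r′) r = step xy (Reach-trans r′ r)

Reach-sym : {G : Graph n} {x y : Fin n} → Reach G x y → Reach G y x
Reach-sym             here                    = here
Reach-sym {G = G} {x} (step {y = y} xy r) =
  Reach-trans (Reach-sym r) (step (trans (Graph.sym G y x) xy) here)

connected-of-path : (G : Graph (suc n)) → (∀ i → adj G (suc i) (inject₁ i) ≡ true) → Connected G
connected-of-path G path x y = Reach-trans (reach-zero x) (Reach-sym (reach-zero y))
  where
  reach-zero : ∀ x → Reach G x zero
  reach-zero = <-weakInduction (λ x → Reach G x zero) here (λ i r → step (path i) r)

connected⇒noIsolated : 2 ≤ n → (G : Graph n) → Connected G → NoIsolated G
connected⇒noIsolated (s≤s (s≤s z≤n)) G conn zero with conn zero (suc zero)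
... | step {y = y} xy _ = y , xy
connected⇒noIsolated (s≤s (s≤s z≤n)) G conn (suc i) with conn (suc i) zero
... | step {y = y} xy _ = y , xy

Confusable : Graph n → ℕ → Subset n → Subset n → Set
Confusable G ℓ X Y = X ≢ Y × ∣ X ∣ ≤ ℓ × ∣ Y ∣ ≤ ℓ × NS[ G ∣ X ] ≡ NS[ G ∣ Y ]

confusable? : (G : Graph n) (ℓ : ℕ) (X Y : Subset n) → Dec (Confusable G ℓ X Y)
confusable? G ℓ X Y =
  ¬? (X ≟ˢ Y) ×-dec ∣ X ∣ ≤? ℓ ×-dec ∣ Y ∣ ≤? ℓ ×-dec NS[ G ∣ X ] ≟ˢ NS[ G ∣ Y ]
  where _≟ˢ_ = ≡-decᵛ _≟ᵇ_

InGr⇒¬confusable : (G : Graph n) {ℓ : ℕ} → InGr G n ℓ → ∀ X Y → ¬ Confusable G ℓ X Y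
InGr⇒¬confusable {n} G identifying X Y (X≢Y , ∣X∣≤ℓ , ∣Y∣≤ℓ , NX≡NY) =
  identifying ⊤ (∣⊤∣≡n n) X Y X≢Y ∣X∣≤ℓ ∣Y∣≤ℓ (cong (_∩ ⊤) NX≡NY)

¬confusable⇒InGr : (G : Graph n) {ℓ : ℕ} → (∀ X Y → ¬ Confusable G ℓ X Y) → InGr G n ℓ
¬confusable⇒InGr G ¬conf C ∣C∣≡n X Y X≢Y ∣X∣≤ℓ ∣Y∣≤ℓ NX∩C≡NY∩C =
  ¬conf X Y (X≢Y , ∣X∣≤ℓ , ∣Y∣≤ℓ , NX≡NY)
  where
  open ≡-Reasoning
  C≡⊤ = ∣p∣≡n⇒p≡⊤ ∣C∣≡n
  NX≡NY : NS[ G ∣ X ] ≡ NS[ G ∣ Y ]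
  NX≡NY = begin
    NS[ G ∣ X ]     ≡⟨ ≡.sym (∩-identityʳ _) ⟩
    NS[ G ∣ X ] ∩ ⊤ ≡⟨ cong (NS[ G ∣ X ] ∩_) (≡.sym C≡⊤) ⟩
    NS[ G ∣ X ] ∩ C ≡⟨ NX∩C≡NY∩C ⟩
    NS[ G ∣ Y ] ∩ C ≡⟨ cong (NS[ G ∣ Y ] ∩_) C≡⊤ ⟩
    NS[ G ∣ Y ] ∩ ⊤ ≡⟨ ∩-identityʳ _ ⟩
    NS[ G ∣ Y ]     ∎

anyFin-cong : {f g : Fin n → Bool} → (∀ x → f x ≡ g x) → anyFin f ≡ anyFin g
anyFin-cong {zero}  f≗g = refl
anyFin-cong {suc n} f≗g = cong₂ _∨_ (f≗g zero) (anyFin-cong (f≗g ∘ suc))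

module _ (G H : Graph n) (same : ∀ x y → adj G x y ≡ adj H x y) where

  N-cong : ∀ x y → lookup N[ G ∣ x ] y ≡ lookup N[ H ∣ x ] y
  N-cong x y = begin
    lookup N[ G ∣ x ] y     ≡⟨ lookup∘tabulate _ y ⟩
    ⌊ x ≟ y ⌋ ∨ adj G x y   ≡⟨ cong (⌊ x ≟ y ⌋ ∨_) (same x y) ⟩
    ⌊ x ≟ y ⌋ ∨ adj H x y   ≡⟨ lookup∘tabulate _ y ⟨
    lookup N[ H ∣ x ] y     ∎
    where open ≡-Reasoning

  NS-cong : ∀ X → NS[ G ∣ X ] ≡ NS[ H ∣ X ]
  NS-cong X = tabulate-cong λ y → anyFin-cong λ x → cong (lookup X x ∧_) (N-cong x y)

  confusable-cong : ∀ {ℓ X Y} → Confusable H ℓ X Y → Confusable G ℓ X Y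
  confusable-cong {X = X} {Y} (X≢Y , ∣X∣≤ℓ , ∣Y∣≤ℓ , NX≡NY) =
    X≢Y , ∣X∣≤ℓ , ∣Y∣≤ℓ , trans (NS-cong X) (trans NX≡NY (≡.sym (NS-cong Y)))

  noIsolated-cong : NoIsolated G → NoIsolated H
  noIsolated-cong noIso x = let (y , xy) = noIso x in y , trans (≡.sym (same x y)) xy

-- The row of vertex 0 lists its neighbours among 1, …, n-1; the rest codes the graph on 1, …, n-1.
Code : ℕ → Set
Code zero    = Unit
Code (suc n) = Subset n × Code n

adjᶜ : Code n → Fin n → Fin n → Bool
adjᶜ (row , c) zero    zero    = false
adjᶜ (row , c) zero    (suc j) = lookup row j
adjᶜ (row , c) (suc i) zero    = lookup row i
adjᶜ (row , c) (suc i) (suc j) = adjᶜ c i j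

adjᶜ-sym : (c : Code n) → ∀ x y → adjᶜ c x y ≡ adjᶜ c y x
adjᶜ-sym (row , c) zero    zero    = refl
adjᶜ-sym (row , c) zero    (suc j) = refl
adjᶜ-sym (row , c) (suc i) zero    = refl
adjᶜ-sym (row , c) (suc i) (suc j) = adjᶜ-sym c i j

adjᶜ-irrefl : (c : Code n) → ∀ x → adjᶜ c x x ≡ false
adjᶜ-irrefl (row , c) zero    = refl
adjᶜ-irrefl (row , c) (suc i) = adjᶜ-irrefl c i

fromCode : Code n → Graph n
fromCode c = record { adj = adjᶜ c ; sym = adjᶜ-sym c ; irrefl = adjᶜ-irrefl c }

deleteZero : Graph (suc n) → Graph n
deleteZero G = record
  { adj    = λ i j → adj G (suc i) (suc j)
  ; sym    = λ i j → Graph.sym G (suc i) (suc j)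
  ; irrefl = λ i → irrefl G (suc i)
  }

code : Graph n → Code n
code {zero}  G = tt
code {suc n} G = tabulate (adj G zero ∘ suc) , code (deleteZero G)

adj-fromCode-code : (G : Graph n) → ∀ x y → adj G x y ≡ adj (fromCode (code G)) x y
adj-fromCode-code G zero    zero    = irrefl G zero
adj-fromCode-code G zero    (suc j) = ≡.sym (lookup∘tabulate _ j)
adj-fromCode-code G (suc i) zero    = trans (Graph.sym G (suc i) zero) (≡.sym (lookup∘tabulate _ i))
adj-fromCode-code G (suc i) (suc j) = adj-fromCode-code (deleteZero G) i j

-- The quantifier over all codes is checked by a plain boolean fold, asserted as "≡ true":
-- folding over Dec values makes the type checker retain the whole search tree, and checking
-- "tt : T b" instead of "refl : b ≡ true" is several times slower.
allSubsets : (Subset n → Bool) → Bool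
allSubsets {zero}  f = f []
allSubsets {suc n} f = allSubsets (f ∘ (true ∷_)) ∧ allSubsets (f ∘ (false ∷_))

allSubsets-sound : (f : Subset n → Bool) → T (allSubsets f) → ∀ p → T (f p)
allSubsets-sound {zero}  f holds []          = holds
allSubsets-sound {suc n} f holds (true ∷ p)  = allSubsets-sound (f ∘ (true ∷_)) (proj₁ (T-∧ .to holds)) p
allSubsets-sound {suc n} f holds (false ∷ p) = allSubsets-sound (f ∘ (false ∷_)) (proj₂ (T-∧ .to holds)) p

allCodes : (Code n → Bool) → Bool
allCodes {zero}  f = f tt
allCodes {suc n} f = allSubsets λ row → allCodes λ c → f (row , c)

allCodes-sound : (f : Code n → Bool) → T (allCodes f) → ∀ c → T (f c)
allCodes-sound {zero}  f holds tt        = holds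
allCodes-sound {suc n} f holds (row , c) =
  allCodes-sound (λ c → f (row , c)) (allSubsets-sound _ holds row) c

witness : {A : Set} (a? : Dec A) → T (does a?) → A
witness (true because [a]) _ = invert [a]

allCodes-witness : {P : Code n → Set} (P? : ∀ c → Dec (P c)) → allCodes (does ∘ P?) ≡ true → ∀ c → P c
allCodes-witness P? holds c = witness (P? c) (allCodes-sound (does ∘ P?) (T-≡ .from holds) c)

noIsolated? : (G : Graph n) → Dec (NoIsolated G)
noIsolated? G = all? λ x → any? λ y → adj G x y ≟ᵇ true

subsets≤ : ℕ → List (Subset n)
subsets≤ {zero}  k       = [] ∷ []
subsets≤ {suc n} zero    = map (false ∷_) (subsets≤ zero)
subsets≤ {suc n} (suc k) = map (true ∷_) (subsets≤ k) ++ map (false ∷_) (subsets≤ (suc k))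

pairs : {A : Set} → List A → List (A × A)
pairs []       = []
pairs (x ∷ xs) = map (x ,_) xs ++ pairs xs

SmallConfusion : Graph n → ℕ → Set
SmallConfusion G ℓ = Any (uncurry (Confusable G ℓ)) (pairs (subsets≤ ℓ))

smallConfusion? : (G : Graph n) (ℓ : ℕ) → Dec (SmallConfusion G ℓ)
smallConfusion? G ℓ = anyˡ? (λ (X , Y) → confusable? G ℓ X Y) (pairs (subsets≤ ℓ))

smallConfusion⇒confusable : {G : Graph n} {ℓ : ℕ} → SmallConfusion G ℓ → ∃₂ (Confusable G ℓ)
smallConfusion⇒confusable confusion = let ((X , Y) , XY) = satisfied confusion in X , Y , XY

noIsolated→smallConfusion? : (G : Graph n) (ℓ : ℕ) → Dec (NoIsolated G → SmallConfusion G ℓ)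
noIsolated→smallConfusion? G ℓ = noIsolated? G →-dec smallConfusion? G ℓ

noIsolated⇒smallConfusionᵇ : ℕ → ℕ → Bool
noIsolated⇒smallConfusionᵇ n ℓ = allCodes {n} λ c → does (noIsolated→smallConfusion? (fromCode c) ℓ)

noIsolated⇒confusable : ∀ {n ℓ} → noIsolated⇒smallConfusionᵇ n ℓ ≡ true →
                        (G : Graph n) → NoIsolated G → ∃₂ (Confusable G ℓ)
noIsolated⇒confusable {ℓ = ℓ} holds G noIsolated =
  let (X , Y , XY) = smallConfusion⇒confusable {G = H}
                       (smallConfusion (noIsolated-cong G H same noIsolated))
  in X , Y , confusable-cong G H same XY
  where
  H    = fromCode (code G)
  same = adj-fromCode-code G
  smallConfusion : NoIsolated H → SmallConfusion H ℓ
  smallConfusion = allCodes-witness (λ c → noIsolated→smallConfusion? (fromCode c) ℓ) holds (code G)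

-- The cycle 0 - 1 - ⋯ - 6 - 0.
C₇ : Graph 7
C₇ = fromCode ( (true ∷ false ∷ false ∷ false ∷ false ∷ true ∷ [])
              , (true ∷ false ∷ false ∷ false ∷ false ∷ [])
              , (true ∷ false ∷ false ∷ false ∷ [])
              , (true ∷ false ∷ false ∷ [])
              , (true ∷ false ∷ [])
              , (true ∷ [])
              , []
              , tt )

C₇-connected : Connected C₇
C₇-connected = connected-of-path C₇ (from-yes (all? λ i → adj C₇ (suc i) (inject₁ i) ≟ᵇ true))

C₇-InGr : InGr C₇ 7 2
C₇-InGr = ¬confusable⇒InGr C₇ λ X Y XY →
  from-no (anySubset? λ X → anySubset? λ Y → confusable? C₇ 2 X Y) (X , Y , XY)

noIsolated⇒smallConfusion-below-7 : 2 ≤ n → n < 7 → noIsolated⇒smallConfusionᵇ n 2 ≡ true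
noIsolated⇒smallConfusion-below-7 {1} (s≤s ()) _
noIsolated⇒smallConfusion-below-7 {2} _ _ = refl
noIsolated⇒smallConfusion-below-7 {3} _ _ = refl
noIsolated⇒smallConfusion-below-7 {4} _ _ = refl
noIsolated⇒smallConfusion-below-7 {5} _ _ = refl
noIsolated⇒smallConfusion-below-7 {6} _ _ = refl
noIsolated⇒smallConfusion-below-7 {suc (suc (suc (suc (suc (suc (suc _))))))} _ (s≤s (s≤s (s≤s (s≤s (s≤s (s≤s (s≤s ())))))))

noIsolated⇒¬InGr-below-7 : 2 ≤ n → n < 7 → (G : Graph n) → NoIsolated G → ¬ InGr G n 2
noIsolated⇒¬InGr-below-7 2≤n n<7 G noIsolated identifying =
  let (X , Y , XY) = noIsolated⇒confusable (noIsolated⇒smallConfusion-below-7 2≤n n<7) G noIsolated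
  in InGr⇒¬confusable G identifying X Y XY

theorem42 : ((Σ (Graph 7) λ G → Connected G × InGr G 7 2) ×
    (∀ (n : ℕ) → 2 ≤ n → n < 7 → ¬ (Σ (Graph n) λ G → Connected G × InGr G n 2)))
    ×
    ((Σ (Graph 7) λ G → NoIsolated G × InGr G 7 2) ×
    (∀ (n : ℕ) → 2 ≤ n → n < 7 → ¬ (Σ (Graph n) λ G → NoIsolated G × InGr G n 2)))
theorem42 =
  ( (C₇ , C₇-connected , C₇-InGr)
  , λ n 2≤n n<7 (G , connected , identifying) →
      noIsolated⇒¬InGr-below-7 2≤n n<7 G (connected⇒noIsolated 2≤n G connected) identifying )
  , ( (C₇ , connected⇒noIsolated (s≤s (s≤s z≤n)) C₇ C₇-connected , C₇-InGr)
    , λ n 2≤n n<7 (G , noIsolated , identifying) →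
        noIsolated⇒¬InGr-below-7 2≤n n<7 G noIsolated identifying )
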